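{- Let $q\ge0$, $t\ge1$, $k\ge1$ be integers. A configuration $C=[c_1,\dots,c_k]$ of the dollar game on $W_k(q,t)$ is critical if and only if the cyclic sequence $c_1,\dots,c_k$ is a circular concatenation of blocks (cyclically consecutive entries) each of one of the forms $$B,M_1,\dots,M_j\qquad\text{or}\qquad B,M_1,\dots,M_j,0\qquad\text{or}\qquad B,M_1,\dots,M_j,0,q,q,\dots,q,$$ where $j\ge0$, $B\in\{1+q,\dots,q+t\}$ and each $M_i\in\{1,\dots,q\}$ (the values of $B$, the $M_i$, $j$ and the number of trailing $q$'s may differ from block to block).
   Context: $W_k(q,t)$ is the directed multigraph with hub $v_0$ and rim vertices $v_1,\dots,v_k$ in clockwise order (indices mod $k$), with $t$ edges each way between $v_0$ and each $v_i$, one edge $v_i\to v_{i-1}$ and $q$ edges $v_i\to v_{i+1}$. Dollar game: a configuration is a vector $C=[c_1,\dots,c_k]$ of nonnegative integers; the bank $v_0$ holds $c_0=-(c_1+\dots+c_k)$. A rim vertex $v_i$ may fire if $c_i\ge 1+q+t$; firing decreases $c_i$ by $1+q+t$, increases $c_{i+1}$ by $q$, $c_{i-1}$ by $1$ (indices mod $k$) and $c_0$ by $t$. The bank may fire only when no rim vertex can fire; firing it adds $t$ to every $c_i$ and subtracts $kt$ from $c_0$. A configuration is stable if no rim vertex can fire, recurrent if some nonempty legal sequence of firings leads from it back to itself, and critical if it is both stable and recurrent. -}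

module Defs where

open import Data.Nat using (ℕ; zero; suc; _+_; _∸_; _≤_; _<_; NonZero)
open import Data.Nat.DivMod using (_%_; m%n<n)
open import Data.Fin using (Fin; toℕ; fromℕ<)
open import Data.Vec using (Vec; lookup; updateAt; map; toList)
open import Data.List using (List; []; _∷_; _++_; [_]; replicate; concat; drop; take)
open import Data.List.Relation.Unary.All using (All)
open import Data.Product using (∃; _×_)
open import Relation.Binary.PropositionalEquality using (_≡_)
open import Relation.Binary.Construct.Closure.Transitive using (TransClosure)

-- A configuration is the rim vector
-- [c_1,…,c_k] ∈ ℕ^k (vertex v_{i+1} ↦ index i : Fin k); the bank value
-- c_0 = -(c_1+…+c_k) is determined by it (firings conserve the total).

module _ (k : ℕ) .{{_ : NonZero k}} where

  next : Fin k → Fin k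
  next i = fromℕ< (m%n<n (toℕ i + 1) k)

  prev : Fin k → Fin k
  prev i = fromℕ< (m%n<n (toℕ i + (k ∸ 1)) k)

Config : ℕ → Set
Config k = Vec ℕ k

module _ (q t k : ℕ) .{{_ : NonZero k}} where

  CanFire : Config k → Fin k → Set
  CanFire C i = 1 + q + t ≤ lookup C i

  Stable : Config k → Set
  Stable C = ∀ i → lookup C i < 1 + q + t

  fireRim : Config k → Fin k → Config k
  fireRim C i =
    updateAt (updateAt (updateAt C i (λ c → c ∸ (1 + q + t))) (next k i) (λ c → c + q))
             (prev k i) (λ c → c + 1)

  fireBank : Config k → Config k
  fireBank C = map (λ c → c + t) C

  data Fire : Config k → Config k → Set where
    rim  : ∀ {C} (i : Fin k) → CanFire C i → Fire C (fireRim C i)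
    bank : ∀ {C} → Stable C → Fire C (fireBank C)

  Recurrent : Config k → Set
  Recurrent C = TransClosure Fire C C

  Critical : Config k → Set
  Critical C = Stable C × Recurrent C

module _ (q t : ℕ) where

  IsB : ℕ → Set
  IsB B = (1 + q ≤ B) × (B ≤ q + t)

  IsM : ℕ → Set
  IsM M = (1 ≤ M) × (M ≤ q)

  data IsBlock : List ℕ → Set where
    form1 : ∀ {B Ms} → IsB B → All IsM Ms → IsBlock (B ∷ Ms)
    form2 : ∀ {B Ms} → IsB B → All IsM Ms → IsBlock (B ∷ Ms ++ [ 0 ])
    form3 : ∀ {B Ms} (m : ℕ) → IsB B → All IsM Ms →
            IsBlock (B ∷ Ms ++ 0 ∷ replicate m q)

rotate : ℕ → List ℕ → List ℕ
rotate r xs = drop r xs ++ take r xs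

CircularBlocks : (q t k : ℕ) → Config k → Set
CircularBlocks q t k C =
  ∃ λ (r : ℕ) → ∃ λ (bs : List (List ℕ)) →
    All (IsBlock q t) bs × (concat bs ≡ rotate r (toList C))

-- A stable configuration is recurrent iff, after the bank fires (adding t to every rim vertex),
-- each rim vertex can be fired once, which restores it (Dhar's burning test). For a critical C,
-- watching which vertex of a set A fires last shows that no nonempty A is forbidden: some v ∈ A
-- holds at least the q·[v₋₁ ∈ A] + [v₊₁ ∈ A] chips that A sends it. Applied to the whole rim and
-- to the arcs starting at a 0, this says that some value exceeds q and that every 0 is followed by
-- q's and then by a value exceeding q. Conversely, under these local conditions some unburnt vertex
-- just past the burnt part can always fire, so burning completes. Read cyclically from a value
-- above q, the local conditions are exactly acceptance by a three-state automaton whose runs are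
-- the block decompositions.

module Submission where

open import Defs
open import Data.Bool using (Bool; true; false; _∨_; _∧_; not; if_then_else_)
import Data.Bool as Bool
open import Data.Bool.Properties using (∨-conicalˡ; ∨-conicalʳ; ∨-zeroʳ; ∧-identityʳ; not-¬; ¬-not)
open import Data.Empty using (⊥-elim)
open import Data.Fin using (Fin; toℕ; fromℕ<) renaming (zero to fzero; suc to fsuc; _≟_ to _≟ᶠ_)
open import Data.Fin.Properties using (toℕ-injective; toℕ<n; toℕ-fromℕ<; any?)
open import Data.List using (List; []; _∷_; _++_; [_]; replicate; concat; length; drop; take)
open import Data.List.Properties using (++-assoc; take-all; drop-all)
open import Data.List.Relation.Unary.All using (All; []; _∷_)
open import Data.List.Relation.Unary.All.Properties using (++⁺)
open import Data.Nat
  using (ℕ; zero; suc; pred; _+_; _*_; _∸_; _%_; _≤_; _<_; NonZero; z≤n; s≤s; s≤s⁻¹; _≟_; _≤?_; _<?_)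
open import Data.Nat.DivMod using (_mod_; m%n<n; %-distribˡ-+; m%n%n≡m%n; [m+n]%n≡m%n; m<n⇒m%n≡m)
open import Data.Nat.Properties hiding (_≟_)
open import Algebra.Properties.CommutativeSemigroup +-commutativeSemigroup
  using (interchange; xy∙z≈xz∙y; x∙yz≈y∙xz)
open import Data.Nat.Tactic.RingSolver using (solve-∀)
open import Data.Product using (∃; _×_; _,_; proj₁; proj₂)
open import Data.Sum using (_⊎_; inj₁; inj₂; [_,_]′)
import Data.Sum as Sum
open import Data.Vec using (Vec; lookup; updateAt; toList; []; _∷_)
open import Data.Vec.Properties using (lookup∘updateAt; lookup∘updateAt′; lookup-map)
open import Data.Vec.Relation.Binary.Pointwise.Extensional using (ext; Pointwise-≡⇒≡)
open import Function.Bundles using (_⇔_; mk⇔)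
open import Function.Construct.Composition using (_⇔-∘_)
open import Relation.Binary.Construct.Closure.ReflexiveTransitive using (Star; ε; _◅_)
open import Relation.Binary.Construct.Closure.Transitive using (TransClosure; _∷_) renaming ([_] to [_]⁺)
open import Relation.Binary.PropositionalEquality hiding ([_])
open import Relation.Nullary using (Dec; yes; no; does; ¬_)
open import Relation.Nullary.Decidable using (dec-true; does-⇔; _×-dec_)

-- Cyclic indexing of the rim

module Cyclic (k : ℕ) .{{_ : NonZero k}} where

  toℕ-mod : ∀ p → toℕ (p mod k) ≡ p % k
  toℕ-mod p = toℕ-fromℕ< (m%n<n p k)

  mod-toℕ : ∀ (i : Fin k) → toℕ i mod k ≡ i
  mod-toℕ i = toℕ-injective (trans (toℕ-mod (toℕ i)) (m<n⇒m%n≡m (toℕ<n i)))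

  %-absorbˡ : ∀ a b → (a % k + b) % k ≡ (a + b) % k
  %-absorbˡ a b = begin
    (a % k + b) % k          ≡⟨ %-distribˡ-+ (a % k) b k ⟩
    (a % k % k + b % k) % k  ≡⟨ cong (λ z → (z + b % k) % k) (m%n%n≡m%n a k) ⟩
    (a % k + b % k) % k      ≡⟨ %-distribˡ-+ a b k ⟨
    (a + b) % k              ∎
    where open ≡-Reasoning

  mod-+ : ∀ a b → (toℕ (a mod k) + b) mod k ≡ (a + b) mod k
  mod-+ a b = toℕ-injective (begin
    toℕ ((toℕ (a mod k) + b) mod k)  ≡⟨ toℕ-mod _ ⟩
    (toℕ (a mod k) + b) % k          ≡⟨ cong (λ z → (z + b) % k) (toℕ-mod a) ⟩
    (a % k + b) % k                  ≡⟨ %-absorbˡ a b ⟩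
    (a + b) % k                      ≡⟨ toℕ-mod (a + b) ⟨
    toℕ ((a + b) mod k)              ∎)
    where open ≡-Reasoning

  mod-+-periodic : ∀ p → (p + k) mod k ≡ p mod k
  mod-+-periodic p = toℕ-injective (trans (toℕ-mod (p + k)) (trans ([m+n]%n≡m%n p k) (sym (toℕ-mod p))))

  next-mod : ∀ p → next k (p mod k) ≡ suc p mod k
  next-mod p = trans (mod-+ p 1) (cong (_mod k) (+-comm p 1))

  prev-mod : ∀ p → prev k (suc p mod k) ≡ p mod k
  prev-mod p = begin
    prev k (suc p mod k)    ≡⟨ mod-+ (suc p) (k ∸ 1) ⟩
    (suc p + (k ∸ 1)) mod k ≡⟨ cong (_mod k) (trans (sym (+-suc p (k ∸ 1))) (cong (p +_) (suc-pred k))) ⟩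
    (p + k) mod k           ≡⟨ mod-+-periodic p ⟩
    p mod k                 ∎
    where open ≡-Reasoning

  prev-next : ∀ i → prev k (next k i) ≡ i
  prev-next i = begin
    prev k (next k i)              ≡⟨ cong (λ j → prev k (next k j)) (mod-toℕ i) ⟨
    prev k (next k (toℕ i mod k))  ≡⟨ cong (prev k) (next-mod (toℕ i)) ⟩
    prev k (suc (toℕ i) mod k)     ≡⟨ prev-mod (toℕ i) ⟩
    toℕ i mod k                    ≡⟨ mod-toℕ i ⟩
    i                              ∎
    where open ≡-Reasoning

  next-prev : ∀ i → next k (prev k i) ≡ i
  next-prev i = begin
    next k (prev k i)                 ≡⟨ next-mod (toℕ i + (k ∸ 1)) ⟩
    suc (toℕ i + (k ∸ 1)) mod k       ≡⟨ cong (_mod k) (trans (sym (+-suc (toℕ i) (k ∸ 1)))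
                                                                (cong (toℕ i +_) (suc-pred k))) ⟩
    (toℕ i + k) mod k                 ≡⟨ mod-+-periodic (toℕ i) ⟩
    toℕ i mod k                       ≡⟨ mod-toℕ i ⟩
    i                                 ∎
    where open ≡-Reasoning

  mod-+-cong : ∀ {a b} e → a mod k ≡ b mod k → (a + e) mod k ≡ (b + e) mod k
  mod-+-cong {a} {b} e eq = trans (sym (mod-+ a e)) (trans (cong (λ i → (toℕ i + e) mod k) eq) (mod-+ b e))

  mod-reach : ∀ p (j : Fin k) → ∃ λ e → e < k × (p + e) mod k ≡ j
  mod-reach p j = d % k , m%n<n d k , toℕ-injective (trans (toℕ-mod (p + d % k)) (begin
      (p + d % k) % k                      ≡⟨ cong (_% k) (+-comm p (d % k)) ⟩
      (d % k + p) % k                      ≡⟨ %-absorbˡ d p ⟩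
      (d + p) % k                          ≡⟨ cong (_% k) (+-comm d p) ⟩
      (p + d) % k                          ≡⟨ %-absorbˡ p d ⟨
      (p % k + (toℕ j + (k ∸ p % k))) % k  ≡⟨ cong (_% k) (x∙yz≈y∙xz (p % k) (toℕ j) (k ∸ p % k)) ⟩
      (toℕ j + (p % k + (k ∸ p % k))) % k  ≡⟨ cong (λ z → (toℕ j + z) % k) (m+[n∸m]≡n (<⇒≤ (m%n<n p k))) ⟩
      (toℕ j + k) % k                      ≡⟨ [m+n]%n≡m%n (toℕ j) k ⟩
      toℕ j % k                            ≡⟨ m<n⇒m%n≡m (toℕ<n j) ⟩
      toℕ j                                ∎))
    where
      open ≡-Reasoning
      d = toℕ j + (k ∸ p % k)

-- Firing and forbidden sets

𝟙 : Bool → ℕ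
𝟙 true  = 1
𝟙 false = 0

𝟙-∨ : ∀ a b → 𝟙 (a ∨ b) ≤ 𝟙 a + 𝟙 b
𝟙-∨ true  b = s≤s z≤n
𝟙-∨ false b = ≤-refl

𝟙-∧ : ∀ a b → 𝟙 (a ∧ b) ≤ 𝟙 b
𝟙-∧ true  b = ≤-refl
𝟙-∧ false b = z≤n

split-true-false : ∀ a b → (a ≡ true × b ≡ false) ⊎ (a ≡ false ⊎ b ≡ true)
split-true-false true  false = inj₁ (refl , refl)
split-true-false true  true  = inj₂ (inj₂ refl)
split-true-false false b     = inj₂ (inj₁ refl)

∨-trueˡ : ∀ {a} b → a ≡ true → a ∨ b ≡ true
∨-trueˡ b refl = refl

∨-trueʳ : ∀ a {b} → b ≡ true → a ∨ b ≡ true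
∨-trueʳ a refl = ∨-zeroʳ a

module _ {A : Set} {R : A → A → Set} where

  ⁺-uncons : ∀ {x z} → TransClosure R x z → ∃ λ y → R x y × Star R y z
  ⁺-uncons [ r ]⁺    = _ , r , ε
  ⁺-uncons (r ∷ rs) with ⁺-uncons rs
  ... | _ , r′ , rs′ = _ , r , r′ ◅ rs′

  ◅⋆⇒⁺ : ∀ {x y z} → R x y → Star R y z → TransClosure R x z
  ◅⋆⇒⁺ r ε        = [ r ]⁺
  ◅⋆⇒⁺ r (r′ ◅ rs) = r ∷ ◅⋆⇒⁺ r′ rs

module Equality (k : ℕ) .{{_ : NonZero k}} where
  open Cyclic k

  infix 4 _==_
  _==_ : Fin k → Fin k → Bool
  i == j = does (i ≟ᶠ j)

  ==-refl : ∀ i → (i == i) ≡ true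
  ==-refl i = dec-true (i ≟ᶠ i) refl

  ==⇒≡ : ∀ {i j} → (i == j) ≡ true → i ≡ j
  ==⇒≡ {i} {j} e with i ≟ᶠ j
  ... | yes i≡j = i≡j

  ==-sym : ∀ i j → (i == j) ≡ (j == i)
  ==-sym i j = does-⇔ (mk⇔ sym sym) (i ≟ᶠ j) (j ≟ᶠ i)

  ==-next : ∀ u w → (u == next k w) ≡ (w == prev k u)
  ==-next u w = does-⇔ (mk⇔ (λ e → trans (sym (prev-next w)) (cong (prev k) (sym e)))
                               (λ e → trans (sym (next-prev u)) (cong (next k) (sym e))))
                        (u ≟ᶠ next k w) (w ≟ᶠ prev k u)

  ==-prev : ∀ u w → (u == prev k w) ≡ (w == next k u)
  ==-prev u w = sym (==-next w u)

  lookup-updateAt : ∀ (xs : Vec ℕ k) j f i →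
                    lookup (updateAt xs j f) i ≡ (if i == j then f (lookup xs i) else lookup xs i)
  lookup-updateAt xs j f i with i ≟ᶠ j
  ... | yes refl = lookup∘updateAt i xs
  ... | no  i≢j  = lookup∘updateAt′ i j i≢j xs

module Firing (q t k : ℕ) .{{_ : NonZero k}} where
  open Cyclic k
  open Equality k

  outdeg : ℕ
  outdeg = 1 + q + t

  indegree : (Fin k → Bool) → Fin k → ℕ
  indegree A v = q * 𝟙 (A (prev k v)) + 𝟙 (A (next k v))

  indegree-∨ : ∀ (A B : Fin k → Bool) v → indegree (λ x → A x ∨ B x) v ≤ indegree A v + indegree B v
  indegree-∨ A B v = begin
    q * 𝟙 (A p ∨ B p) + 𝟙 (A n ∨ B n)
      ≤⟨ +-mono-≤ (*-monoʳ-≤ q (𝟙-∨ (A p) (B p))) (𝟙-∨ (A n) (B n)) ⟩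
    q * (𝟙 (A p) + 𝟙 (B p)) + (𝟙 (A n) + 𝟙 (B n))
      ≡⟨ cong (_+ (𝟙 (A n) + 𝟙 (B n))) (*-distribˡ-+ q (𝟙 (A p)) (𝟙 (B p))) ⟩
    (q * 𝟙 (A p) + q * 𝟙 (B p)) + (𝟙 (A n) + 𝟙 (B n))
      ≡⟨ interchange (q * 𝟙 (A p)) (q * 𝟙 (B p)) (𝟙 (A n)) (𝟙 (B n)) ⟩
    indegree A v + indegree B v ∎
    where
      open ≤-Reasoning
      p = prev k v
      n = next k v

  indegree-∧ : ∀ (A B : Fin k → Bool) v → indegree (λ x → A x ∧ B x) v ≤ indegree B v
  indegree-∧ A B v =
    +-mono-≤ (*-monoʳ-≤ q (𝟙-∧ (A (prev k v)) (B (prev k v)))) (𝟙-∧ (A (next k v)) (B (next k v)))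

  -- w sends q chips to next w and one to prev w: i receives q iff w = prev i, one iff w = next i
  lookup-fireRim : ∀ D w i → outdeg ≤ lookup D w →
                   lookup (fireRim q t k D w) i + 𝟙 (i == w) * outdeg ≡ lookup D i + indegree (w ==_) i
  lookup-fireRim D w i outdeg≤ = begin
    lookup (fireRim q t k D w) i + 𝟙 (i == w) * outdeg
      ≡⟨ cong (_+ 𝟙 (i == w) * outdeg) (begin
           lookup (fireRim q t k D w) i
             ≡⟨ lookup-updateAt D₂ (prev k w) (_+ 1) i ⟩
           (if i == prev k w then lookup D₂ i + 1 else lookup D₂ i)
             ≡⟨ trans (if-+ (i == prev k w) 1 _) (cong (lookup D₂ i +_) (*-identityˡ _)) ⟩
           lookup D₂ i + 𝟙 (i == prev k w)
             ≡⟨ cong (_+ 𝟙 (i == prev k w))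
                     (trans (lookup-updateAt D₁ (next k w) (_+ q) i) (if-+ (i == next k w) q _)) ⟩
           lookup D₁ i + q * 𝟙 (i == next k w) + 𝟙 (i == prev k w)
             ≡⟨ cong (λ x → x + q * 𝟙 (i == next k w) + 𝟙 (i == prev k w))
                     (lookup-updateAt D w (_∸ outdeg) i) ⟩
           c + q * 𝟙 (i == next k w) + 𝟙 (i == prev k w) ∎) ⟩
    c + q * 𝟙 (i == next k w) + 𝟙 (i == prev k w) + 𝟙 (i == w) * outdeg
      ≡⟨ +-comm-last c _ _ _ ⟩
    (c + 𝟙 (i == w) * outdeg) + q * 𝟙 (i == next k w) + 𝟙 (i == prev k w)
      ≡⟨ cong₂ (λ x b → x + q * 𝟙 b + 𝟙 (i == prev k w)) (if-∸ (i == w) _ fired-here) (==-next i w) ⟩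
    lookup D i + q * 𝟙 (w == prev k i) + 𝟙 (i == prev k w)
      ≡⟨ cong (λ b → lookup D i + q * 𝟙 (w == prev k i) + 𝟙 b) (==-prev i w) ⟩
    lookup D i + q * 𝟙 (w == prev k i) + 𝟙 (w == next k i)
      ≡⟨ +-assoc (lookup D i) _ _ ⟩
    lookup D i + indegree (w ==_) i ∎
    where
      open ≡-Reasoning
      D₁ = updateAt D w (_∸ outdeg)
      D₂ = updateAt D₁ (next k w) (_+ q)
      c = if i == w then lookup D i ∸ outdeg else lookup D i
      fired-here : (i == w) ≡ true → outdeg ≤ lookup D i
      fired-here e = subst (λ j → outdeg ≤ lookup D j) (sym (==⇒≡ e)) outdeg≤
      if-+ : ∀ b n x → (if b then x + n else x) ≡ x + n * 𝟙 b
      if-+ true  n x = cong (x +_) (sym (*-identityʳ n))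
      if-+ false n x = sym (trans (cong (x +_) (*-zeroʳ n)) (+-identityʳ x))
      if-∸ : ∀ b x → (b ≡ true → outdeg ≤ x) → (if b then x ∸ outdeg else x) + 𝟙 b * outdeg ≡ x
      if-∸ true  x h = trans (cong (x ∸ outdeg +_) (+-identityʳ outdeg)) (m∸n+n≡m (h refl))
      if-∸ false x h = +-identityʳ x
      +-comm-last : ∀ a b c d → a + b + c + d ≡ (a + d) + b + c
      +-comm-last = solve-∀

  fireRim-self : ∀ D u → outdeg ≤ lookup D u → indegree (u ==_) u ≤ lookup (fireRim q t k D u) u
  fireRim-self D u outdeg≤ = +-cancelʳ-≤ outdeg _ _ (begin
    indegree (u ==_) u + outdeg               ≤⟨ +-monoʳ-≤ _ outdeg≤ ⟩
    indegree (u ==_) u + lookup D u           ≡⟨ +-comm _ (lookup D u) ⟩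
    lookup D u + indegree (u ==_) u           ≡⟨ lookup-fireRim D u u outdeg≤ ⟨
    lookup D' u + 𝟙 (u == u) * outdeg         ≡⟨ cong (λ b → lookup D' u + 𝟙 b * outdeg) (==-refl u) ⟩
    lookup D' u + 1 * outdeg                  ≡⟨ cong (lookup D' u +_) (*-identityˡ outdeg) ⟩
    lookup D' u + outdeg                      ∎)
    where
      open ≤-Reasoning
      D' = fireRim q t k D u

  fireRim-other : ∀ D w u → outdeg ≤ lookup D w → (u == w) ≡ false →
                  lookup (fireRim q t k D w) u ≡ lookup D u + indegree (w ==_) u
  fireRim-other D w u outdeg≤ u≠w =
    trans (sym (trans (cong (λ b → lookup (fireRim q t k D w) u + 𝟙 b * outdeg) u≠w) (+-identityʳ _)))
          (lookup-fireRim D w u outdeg≤)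

  lookup-fireBank : ∀ D u → lookup (fireBank q t k D) u ≡ lookup D u + t
  lookup-fireBank D u = lookup-map u (_+ t) D

  indegree-cong : ∀ {A B : Fin k → Bool} → (∀ x → A x ≡ B x) → ∀ v → indegree A v ≡ indegree B v
  indegree-cong A≗B v = cong₂ (λ a b → q * 𝟙 a + 𝟙 b) (A≗B (prev k v)) (A≗B (next k v))

  indegree-∅ : ∀ v → indegree (λ _ → false) v ≡ 0
  indegree-∅ v = trans (+-identityʳ (q * 0)) (*-zeroʳ q)

  Path : Config k → Config k → Set
  Path = Star (Fire q t k)

  fired : ∀ {D E} → Path D E → Fin k → Bool
  fired ε                 v = false
  fired (rim u _ ◅ p)    v = (u == v) ∨ fired p v
  fired (bank _ ◅ p)     v = fired p v

  unfired-gain : ∀ {D E} (p : Path D E) u → fired p u ≡ false →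
                 lookup D u + indegree (fired p) u ≤ lookup E u
  unfired-gain {D} ε u _ = ≤-reflexive (trans (cong (lookup D u +_) (indegree-∅ u)) (+-identityʳ _))
  unfired-gain (bank {D} _ ◅ p) u unfired = begin
    lookup D u + indegree (fired p) u
      ≤⟨ +-monoˡ-≤ (indegree (fired p) u) (m≤m+n (lookup D u) t) ⟩
    lookup D u + t + indegree (fired p) u
      ≡⟨ cong (_+ indegree (fired p) u) (lookup-fireBank D u) ⟨
    lookup (fireBank q t k D) u + indegree (fired p) u
      ≤⟨ unfired-gain p u unfired ⟩
    _ ∎
    where open ≤-Reasoning
  unfired-gain (rim {D} w outdeg≤ ◅ p) u unfired = begin
    lookup D u + indegree (λ x → (w == x) ∨ fired p x) u
      ≤⟨ +-monoʳ-≤ (lookup D u) (indegree-∨ (w ==_) (fired p) u) ⟩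
    lookup D u + (indegree (w ==_) u + indegree (fired p) u)
      ≡⟨ +-assoc (lookup D u) _ _ ⟨
    lookup D u + indegree (w ==_) u + indegree (fired p) u
      ≡⟨ cong (_+ indegree (fired p) u) (fireRim-other D w u outdeg≤ u≠w) ⟨
    lookup (fireRim q t k D w) u + indegree (fired p) u
      ≤⟨ unfired-gain p u (∨-conicalʳ (w == u) (fired p u) unfired) ⟩
    _ ∎
    where
      open ≤-Reasoning
      u≠w = trans (==-sym u w) (∨-conicalˡ (w == u) (fired p u) unfired)

  ∧-∨-absorb : ∀ (A B : Fin k → Bool) u → A u ≡ false ⊎ B u ≡ true →
               ∀ x → A x ∧ ((u == x) ∨ B x) ≡ A x ∧ B x
  ∧-∨-absorb A B u h x with u ≟ᶠ x
  ... | no _ = refl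
  ∧-∨-absorb A B u (inj₁ au) x | yes refl rewrite au = refl
  ∧-∨-absorb A B u (inj₂ bu) x | yes refl rewrite bu = refl

  -- the last vertex of A to fire keeps the chips later sent to it by the fired part of A
  last-firing : ∀ (A : Fin k → Bool) {D E} (p : Path D E) w → A w ≡ true → fired p w ≡ true →
                ∃ λ v → A v ≡ true × fired p v ≡ true ×
                        indegree (λ x → A x ∧ fired p x) v ≤ lookup E v
  last-firing A ε w aw ()
  last-firing A (bank _ ◅ p) w aw fw = last-firing A p w aw fw
  last-firing A {E = E} (rim {D} u outdeg≤ ◅ p) w aw fw with split-true-false (A u) (fired p u)
  ... | inj₁ (au , unfired) = u , au , ∨-trueˡ (fired p u) (==-refl u) , (begin
    indegree (λ x → A x ∧ ((u == x) ∨ fired p x)) u    ≤⟨ indegree-∧ A (λ x → (u == x) ∨ fired p x) u ⟩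
    indegree (λ x → (u == x) ∨ fired p x) u            ≤⟨ indegree-∨ (u ==_) (fired p) u ⟩
    indegree (u ==_) u + indegree (fired p) u           ≤⟨ +-monoˡ-≤ _ (fireRim-self D u outdeg≤) ⟩
    lookup (fireRim q t k D u) u + indegree (fired p) u ≤⟨ unfired-gain p u unfired ⟩
    _                                                   ∎)
    where open ≤-Reasoning
  ... | inj₂ later = from-later (last-firing A p w aw fired-later)
    where
      absorb = ∧-∨-absorb A (fired p) u later
      fired-later : fired p w ≡ true
      fired-later = trans (sym (subst (λ a → a ∧ _ ≡ a ∧ fired p w) aw (absorb w))) fw
      from-later : (∃ λ v → A v ≡ true × fired p v ≡ true ×
                            indegree (λ x → A x ∧ fired p x) v ≤ lookup E v) →
                   ∃ λ v → A v ≡ true × ((u == v) ∨ fired p v) ≡ true ×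
                           indegree (λ x → A x ∧ ((u == x) ∨ fired p x)) v ≤ lookup E v
      from-later (v , av , fv , bound) =
        v , av , ∨-trueʳ (u == v) fv , subst (_≤ lookup E v) (indegree-cong (λ x → sym (absorb x)) v) bound

  -- an unfired rim vertex would end with at least t ≥ 1 chips more than it started with
  return-fires-all : 1 ≤ t → ∀ {C} (p : Path (fireBank q t k C) C) u → fired p u ≡ true
  return-fires-all 1≤t {C} p u with fired p u in unfired
  ... | true  = refl
  ... | false = ⊥-elim (<⇒≱ (begin-strict
    lookup C u                                          <⟨ m<m+n (lookup C u) 1≤t ⟩
    lookup C u + t                                      ≡⟨ lookup-fireBank C u ⟨
    lookup (fireBank q t k C) u                         ≤⟨ m≤m+n _ _ ⟩
    lookup (fireBank q t k C) u + indegree (fired p) u  ∎) (unfired-gain p u unfired))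
    where open ≤-Reasoning

  NoForbiddenSet : Config k → Set
  NoForbiddenSet C = ∀ A w → A w ≡ true → ∃ λ v → A v ≡ true × indegree A v ≤ lookup C v

  -- from a stable configuration only the bank can fire first
  critical⇒noForbiddenSet : 1 ≤ t → ∀ C → Critical q t k C → NoForbiddenSet C
  critical⇒noForbiddenSet 1≤t C (stable , recurrent) A w aw with ⁺-uncons recurrent
  ... | _ , rim i outdeg≤ , _ = ⊥-elim (<⇒≱ (stable i) outdeg≤)
  ... | _ , bank _ , p with last-firing A p w aw (return-fires-all 1≤t p w)
  ...   | v , av , _ , bound = v , av , subst (_≤ lookup C v) (indegree-cong A∧fired≗A v) bound
    where
      A∧fired≗A : ∀ x → A x ∧ fired p x ≡ A x
      A∧fired≗A x = trans (cong (A x ∧_) (return-fires-all 1≤t p x)) (∧-identityʳ (A x))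

-- The local pattern of a critical configuration

does-true : ∀ {P : Set} (d : Dec P) → does d ≡ true → P
does-true (yes p) _ = p

QRun : ℕ → (ℕ → ℕ) → ℕ → ℕ → Set
QRun q c s m = ∀ e → e < m → c (s + e) ≡ q

q-run-or-break : ∀ q (c : ℕ → ℕ) s n → QRun q c s n ⊎ ∃ λ m → m < n × QRun q c s m × c (s + m) ≢ q
q-run-or-break q c s zero = inj₁ (λ e ())
q-run-or-break q c s (suc n) with q-run-or-break q c s n
... | inj₂ (m , m<n , run , c≢q) = inj₂ (m , m<n⇒m<1+n m<n , run , c≢q)
... | inj₁ run with c (s + n) ≟ q
...   | no  c≢q = inj₂ (n , ≤-refl , run , c≢q)
...   | yes c≡q = inj₁ λ e e<1+n →
  [ (λ e<n → run e e<n) , (λ { refl → c≡q }) ]′ (m≤n⇒m<n∨m≡n (s≤s⁻¹ e<1+n))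

ZerosResolved : ℕ → (ℕ → ℕ) → Set
ZerosResolved q c = ∀ p → c p ≡ 0 → ∃ λ m → QRun q c (suc p) m × q < c (suc p + m)

module Pattern (q t k : ℕ) .{{_ : NonZero k}} where
  open Cyclic k
  open Equality k
  open Firing q t k

  infix 10 _⟨_⟩
  _⟨_⟩ : Config k → ℕ → ℕ
  C ⟨ p ⟩ = lookup C (p mod k)

  record CriticalPattern (C : Config k) : Set where
    field
      stable : Stable q t k C
      big    : ∃ λ v → q < lookup C v
      zeros  : ZerosResolved q (C ⟨_⟩)

  indegree-prev : ∀ A v → A (prev k v) ≡ true → q ≤ indegree A v
  indegree-prev A v a = subst (λ b → q ≤ q * 𝟙 b + 𝟙 (A (next k v))) (sym a)
                          (≤-trans (≤-reflexive (sym (*-identityʳ q))) (m≤m+n (q * 1) _))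

  indegree-next : ∀ A v → A (next k v) ≡ true → 1 ≤ indegree A v
  indegree-next A v a = subst (λ b → 1 ≤ q * 𝟙 (A (prev k v)) + 𝟙 b) (sym a) (m≤n+m 1 _)

  indegree-both : ∀ A v → A (prev k v) ≡ true → A (next k v) ≡ true → suc q ≤ indegree A v
  indegree-both A v a b = subst₂ (λ x y → suc q ≤ q * 𝟙 x + 𝟙 y) (sym a) (sym b)
                            (≤-reflexive (trans (+-comm 1 q) (cong (_+ 1) (sym (*-identityʳ q)))))

  noForbiddenSet⇒big : ∀ C → NoForbiddenSet C → ∃ λ v → q < lookup C v
  noForbiddenSet⇒big C noForbidden with noForbidden (λ _ → true) (0 mod k) refl
  ... | v , _ , bound = v , ≤-trans (indegree-both (λ _ → true) v refl refl) bound

  arc : ℕ → ℕ → Fin k → Bool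
  arc p n x = does (any? λ (e : Fin n) → (p + toℕ e) mod k ≟ᶠ x)

  arc-∋ : ∀ p n {e} → e < n → arc p n ((p + e) mod k) ≡ true
  arc-∋ p n {e} e<n = dec-true (any? _) (fromℕ< e<n , cong (λ z → (p + z) mod k) (toℕ-fromℕ< e<n))

  arc-∈ : ∀ p n {x} → arc p n x ≡ true → ∃ λ e → e < n × (p + e) mod k ≡ x
  arc-∈ p n x∈ with does-true (any? _) x∈
  ... | e , eq = toℕ e , toℕ<n e , eq

  arc-next : ∀ p n e → suc e < n → arc p n (next k ((p + e) mod k)) ≡ true
  arc-next p n e lt = subst (λ x → arc p n x ≡ true)
    (trans (cong (_mod k) (+-suc p e)) (sym (next-mod (p + e)))) (arc-∋ p n lt)

  arc-prev : ∀ p n e → e < n → arc p n (prev k ((p + suc e) mod k)) ≡ true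
  arc-prev p n e lt = subst (λ x → arc p n x ≡ true)
    (sym (trans (cong (λ z → prev k (z mod k)) (+-suc p e)) (prev-mod (p + e)))) (arc-∋ p n lt)

  -- otherwise the arc p, p+1, …, p+m+1 would be a forbidden set
  arc-end-≥ : ∀ C → NoForbiddenSet C → ∀ p m → C ⟨ p ⟩ ≡ 0 → QRun q (C ⟨_⟩) (suc p) m →
              q ≤ C ⟨ suc p + m ⟩
  arc-end-≥ C noForbidden p m c≡0 run
    with noForbidden (arc p (2 + m)) ((p + 0) mod k) (arc-∋ p (2 + m) (s≤s z≤n))
  ... | v , v∈ , bound with arc-∈ p (2 + m) v∈
  ... | e , e<2+m , refl = at e e<2+m bound
    where
      A = arc p (2 + m)
      at : ∀ e → e < 2 + m → indegree A ((p + e) mod k) ≤ C ⟨ p + e ⟩ → q ≤ C ⟨ suc p + m ⟩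
      at zero _ bound = ⊥-elim (<⇒≱ (indegree-next A ((p + 0) mod k) next∈A) (≤-trans bound (≤-reflexive c≡0′)))
        where
          next∈A = arc-next p (2 + m) 0 (s≤s (s≤s z≤n))
          c≡0′ = trans (cong (C ⟨_⟩) (+-identityʳ p)) c≡0
      at (suc e) lt bound with m≤n⇒m<n∨m≡n (s≤s⁻¹ (s≤s⁻¹ lt))
      ... | inj₁ e<m = ⊥-elim (<⇒≱ (indegree-both A ((p + suc e) mod k) prev∈A next∈A)
                                   (≤-trans bound (≤-reflexive c≡q)))
        where
          prev∈A = arc-prev p (2 + m) e (≤-trans (n≤1+n _) lt)
          next∈A = arc-next p (2 + m) (suc e) (s≤s (s≤s e<m))
          c≡q = trans (cong (C ⟨_⟩) (+-suc p e)) (run e e<m)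
      ... | inj₂ refl = ≤-trans (indegree-prev A ((p + suc e) mod k) prev∈A)
                                (≤-trans bound (≤-reflexive (cong (C ⟨_⟩) (+-suc p e))))
        where prev∈A = arc-prev p (2 + m) e (≤-trans (n≤1+n _) lt)

  noForbiddenSet⇒zerosResolved : ∀ C → NoForbiddenSet C → ZerosResolved q (C ⟨_⟩)
  noForbiddenSet⇒zerosResolved C noForbidden p c≡0 with q-run-or-break q (C ⟨_⟩) (suc p) k
  ... | inj₂ (m , _ , run , c≢q) =
    m , run , ≤∧≢⇒< (arc-end-≥ C noForbidden p m c≡0 run) (λ eq → c≢q (sym eq))
  ... | inj₁ run with noForbiddenSet⇒big C noForbidden
  ...   | b , q<b with mod-reach (suc p) b
  ...     | e , e<k , refl = ⊥-elim (<-irrefl (sym (run e e<k)) q<b)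

  critical⇒pattern : 1 ≤ t → ∀ C → Critical q t k C → CriticalPattern C
  critical⇒pattern 1≤t C critical = record
    { stable = proj₁ critical
    ; big    = noForbiddenSet⇒big C noForbidden
    ; zeros  = noForbiddenSet⇒zerosResolved C noForbidden
    }
    where noForbidden = critical⇒noForbiddenSet 1≤t C critical

-- The burning algorithm

switch : ∀ (h : ℕ → Bool) b d → h 0 ≡ b → h d ≡ not b →
         ∃ λ e → e < d × h e ≡ b × h (suc e) ≡ not b
switch h b zero    h0 hd = ⊥-elim (not-¬ h0 hd)
switch h b (suc d) h0 hd with h d Bool.≟ b
... | yes hd′ = d , ≤-refl , hd′ , hd
... | no  hd′ with switch h b d h0 (¬-not hd′)
...   | e , e<d , he , he+1 = e , m<n⇒m<1+n e<d , he , he+1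

unburnt : ∀ n → (Fin n → Bool) → ℕ
unburnt zero    F = 0
unburnt (suc n) F = 𝟙 (not (F fzero)) + unburnt n (λ j → F (fsuc j))

unburnt-∅ : ∀ n → unburnt n (λ _ → false) ≡ n
unburnt-∅ zero    = refl
unburnt-∅ (suc n) = cong suc (unburnt-∅ n)

𝟙-not-mono : ∀ {a b} → (a ≡ true → b ≡ true) → 𝟙 (not b) ≤ 𝟙 (not a)
𝟙-not-mono {true}  a⇒b rewrite a⇒b refl = z≤n
𝟙-not-mono {false} {true}  _ = z≤n
𝟙-not-mono {false} {false} _ = ≤-refl

unburnt-mono : ∀ n (F G : Fin n → Bool) → (∀ j → F j ≡ true → G j ≡ true) →
               unburnt n G ≤ unburnt n F
unburnt-mono zero    F G F⊆G = z≤n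
unburnt-mono (suc n) F G F⊆G = +-mono-≤ (𝟙-not-mono (F⊆G fzero)) (unburnt-mono n _ _ (λ j → F⊆G (fsuc j)))

unburnt-mono-< : ∀ n (F G : Fin n → Bool) → (∀ j → F j ≡ true → G j ≡ true) →
                 ∀ w → F w ≡ false → G w ≡ true → unburnt n G < unburnt n F
unburnt-mono-< (suc n) F G F⊆G fzero Fw Gw rewrite Fw | Gw = s≤s (unburnt-mono n _ _ (λ j → F⊆G (fsuc j)))
unburnt-mono-< (suc n) F G F⊆G (fsuc w) Fw Gw =
  +-mono-≤-< (𝟙-not-mono (F⊆G fzero)) (unburnt-mono-< n _ _ (λ j → F⊆G (fsuc j)) w Fw Gw)

module Burning (q t k : ℕ) .{{_ : NonZero k}} where
  open Cyclic k
  open Equality k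
  open Firing q t k
  open Pattern q t k

  boundary : ∀ (F : Fin k → Bool) {b i} → F b ≡ true → F i ≡ false →
             ∃ λ p → F (p mod k) ≡ true × F (suc p mod k) ≡ false
  boundary F {b} {i} Fb Fi with mod-reach (toℕ b) i
  ... | d , _ , reach with switch (λ e → F ((toℕ b + e) mod k)) true d
                             (subst (λ x → F x ≡ true) (sym b+0) Fb)
                             (subst (λ x → F x ≡ false) (sym reach) Fi)
    where b+0 = trans (cong (_mod k) (+-identityʳ (toℕ b))) (mod-toℕ b)
  ...   | e , _ , Fe , Fe+1 = toℕ b + e , Fe , subst (λ x → F (x mod k) ≡ false) (+-suc (toℕ b) e) Fe+1

  module _ (C : Config k) (pat : CriticalPattern C) where
    open CriticalPattern pat

    Ready : (Fin k → Bool) → Fin k → Set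
    Ready F w = F w ≡ false × q < lookup C w + indegree F w

    -- the vertex after p is ready unless it holds 0; then the run of q's after it leads to a
    -- value above q, which is burnt, and the last unburnt vertex before that one is ready
    ready-past-boundary : ∀ (F : Fin k → Bool) → (∀ w → q < lookup C w → F w ≡ true) →
                          ∀ p → F (p mod k) ≡ true → F (suc p mod k) ≡ false → ∃ (Ready F)
    ready-past-boundary F big⇒burnt p Fp Fp+1 with C ⟨ suc p ⟩ ≟ 0
    ... | no c≢0 = suc p mod k , Fp+1 ,
          +-mono-<-≤ (n≢0⇒n>0 c≢0) (indegree-prev F _ (subst (λ x → F x ≡ true) (sym (prev-mod p)) Fp))
    ... | yes c≡0 with zeros (suc p) c≡0
    ...   | m , run , q<end with switch (λ x → F ((suc p + x) mod k)) false (suc m)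
                                   (subst (λ x → F (x mod k) ≡ false) (sym (+-identityʳ (suc p))) Fp+1)
                                   (subst (λ x → F (x mod k) ≡ true) (sym (+-suc (suc p) m)) (big⇒burnt _ q<end))
    ...     | x , x<1+m , Fx , Fx+1 = (suc p + x) mod k , Fx , ready-at x x<1+m next-burnt
      where
        next-burnt : F (next k ((suc p + x) mod k)) ≡ true
        next-burnt = subst (λ y → F y ≡ true)
          (sym (trans (next-mod (suc p + x)) (cong (_mod k) (sym (+-suc (suc p) x))))) Fx+1
        ready-at : ∀ x → x < suc m → F (next k ((suc p + x) mod k)) ≡ true →
                   q < C ⟨ suc p + x ⟩ + indegree F ((suc p + x) mod k)
        ready-at zero _ nb = ≤-trans (indegree-both F _ prev-burnt nb) (m≤n+m _ (C ⟨ suc p + 0 ⟩))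
          where
            prev-burnt : F (prev k ((suc p + 0) mod k)) ≡ true
            prev-burnt = subst (λ y → F y ≡ true)
              (sym (trans (prev-mod (p + 0)) (cong (_mod k) (+-identityʳ p)))) Fp
        ready-at (suc x) lt nb = begin-strict
          q                                        <⟨ n<1+n q ⟩
          1 + q                                    ≡⟨ +-comm 1 q ⟩
          q + 1                                    ≤⟨ +-monoʳ-≤ q (indegree-next F _ nb) ⟩
          q + indegree F ((suc p + suc x) mod k)   ≡⟨ cong (_+ _) c≡q ⟨
          C ⟨ suc p + suc x ⟩ + indegree F ((suc p + suc x) mod k) ∎
          where
            open ≤-Reasoning
            c≡q = trans (cong (C ⟨_⟩) (+-suc (suc p) x)) (run x (s≤s⁻¹ lt))

    burnt-if-big : ∀ (F : Fin k → Bool) → ¬ (∃ λ w → F w ≡ false × q < lookup C w) →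
                   ∀ w → q < lookup C w → F w ≡ true
    burnt-if-big F none w q<c with F w in Fw
    ... | true  = refl
    ... | false = ⊥-elim (none (w , Fw , q<c))

    ready-vertex : ∀ (F : Fin k → Bool) i → F i ≡ false → ∃ (Ready F)
    ready-vertex F i Fi with any? (λ w → (F w Bool.≟ false) ×-dec (suc q ≤? lookup C w))
    ... | yes (w , Fw , q<c) = w , Fw , ≤-trans q<c (m≤m+n _ _)
    ... | no none with boundary F (burnt-if-big F none (proj₁ big) (proj₂ big)) Fi
    ...   | p , Fp , Fp+1 = ready-past-boundary F (burnt-if-big F none) p Fp Fp+1

    -- D arises from C by firing the bank and then every vertex of F once
    Burnt : Config k → (Fin k → Bool) → Set
    Burnt D F = ∀ i → lookup D i + 𝟙 (F i) * outdeg ≡ lookup C i + t + indegree F i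

    burnt-start : Burnt (fireBank q t k C) (λ _ → false)
    burnt-start i = begin
      lookup (fireBank q t k C) i + 0      ≡⟨ +-identityʳ _ ⟩
      lookup (fireBank q t k C) i          ≡⟨ lookup-fireBank C i ⟩
      lookup C i + t                       ≡⟨ +-identityʳ _ ⟨
      lookup C i + t + 0                   ≡⟨ cong (lookup C i + t +_) (indegree-∅ i) ⟨
      lookup C i + t + indegree (λ _ → false) i ∎
      where open ≡-Reasoning

    ready⇒canFire : ∀ {D F w} → Burnt D F → Ready F w → outdeg ≤ lookup D w
    ready⇒canFire {D} {F} {w} burnt (Fw , ready) = begin
      suc q + t                             ≤⟨ +-monoˡ-≤ t ready ⟩
      lookup C w + indegree F w + t         ≡⟨ xy∙z≈xz∙y (lookup C w) (indegree F w) t ⟩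
      lookup C w + t + indegree F w         ≡⟨ burnt w ⟨
      lookup D w + 𝟙 (F w) * outdeg         ≡⟨ cong (λ b → lookup D w + 𝟙 b * outdeg) Fw ⟩
      lookup D w + 0                        ≡⟨ +-identityʳ _ ⟩
      lookup D w                            ∎
      where open ≤-Reasoning

    insert : (Fin k → Bool) → Fin k → Fin k → Bool
    insert F w x = (w == x) ∨ F x

    𝟙-insert : ∀ F w → F w ≡ false → ∀ x → 𝟙 (insert F w x) ≡ 𝟙 (w == x) + 𝟙 (F x)
    𝟙-insert F w Fw x with w ≟ᶠ x
    ... | yes refl rewrite Fw = refl
    ... | no  _    = refl

    indegree-insert : ∀ F w → F w ≡ false →
                      ∀ i → indegree (insert F w) i ≡ indegree (w ==_) i + indegree F i
    indegree-insert F w Fw i = begin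
      q * 𝟙 (insert F w p) + 𝟙 (insert F w n)
        ≡⟨ cong₂ (λ a b → q * a + b) (𝟙-insert F w Fw p) (𝟙-insert F w Fw n) ⟩
      q * (𝟙 (w == p) + 𝟙 (F p)) + (𝟙 (w == n) + 𝟙 (F n))
        ≡⟨ cong (_+ (𝟙 (w == n) + 𝟙 (F n))) (*-distribˡ-+ q (𝟙 (w == p)) (𝟙 (F p))) ⟩
      (q * 𝟙 (w == p) + q * 𝟙 (F p)) + (𝟙 (w == n) + 𝟙 (F n))
        ≡⟨ interchange (q * 𝟙 (w == p)) (q * 𝟙 (F p)) (𝟙 (w == n)) (𝟙 (F n)) ⟩
      indegree (w ==_) i + indegree F i ∎
      where
        open ≡-Reasoning
        p = prev k i
        n = next k i

    burnt-fire : ∀ {D F w} (burnt : Burnt D F) (ready : Ready F w) →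
                 Burnt (fireRim q t k D w) (insert F w)
    burnt-fire {D} {F} {w} burnt ready@(Fw , _) i = begin
      lookup D′ i + 𝟙 (insert F w i) * outdeg
        ≡⟨ cong (λ n → lookup D′ i + n * outdeg)
                (trans (𝟙-insert F w Fw i) (cong (λ b → 𝟙 b + 𝟙 (F i)) (==-sym w i))) ⟩
      lookup D′ i + (𝟙 (i == w) + 𝟙 (F i)) * outdeg
        ≡⟨ split (lookup D′ i) (𝟙 (i == w)) (𝟙 (F i)) outdeg ⟩
      (lookup D′ i + 𝟙 (i == w) * outdeg) + 𝟙 (F i) * outdeg
        ≡⟨ cong (_+ 𝟙 (F i) * outdeg) (lookup-fireRim D w i (ready⇒canFire {D} {F} {w} burnt ready)) ⟩
      lookup D i + indegree (w ==_) i + 𝟙 (F i) * outdeg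
        ≡⟨ xy∙z≈xz∙y (lookup D i) _ _ ⟩
      lookup D i + 𝟙 (F i) * outdeg + indegree (w ==_) i
        ≡⟨ cong (_+ indegree (w ==_) i) (burnt i) ⟩
      lookup C i + t + indegree F i + indegree (w ==_) i
        ≡⟨ +-assoc (lookup C i + t) _ _ ⟩
      lookup C i + t + (indegree F i + indegree (w ==_) i)
        ≡⟨ cong (lookup C i + t +_) (trans (+-comm (indegree F i) _) (sym (indegree-insert F w Fw i))) ⟩
      lookup C i + t + indegree (insert F w) i ∎
      where
        open ≡-Reasoning
        D′ = fireRim q t k D w
        split : ∀ x a b c → x + (a + b) * c ≡ (x + a * c) + b * c
        split = solve-∀

    burnt-all⇒≡ : ∀ {D F} → Burnt D F → (∀ i → F i ≡ true) → D ≡ C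
    burnt-all⇒≡ {D} {F} burnt all = Pointwise-≡⇒≡ (ext λ i → +-cancelʳ-≡ outdeg _ _ (begin
      lookup D i + outdeg                    ≡⟨ cong (lookup D i +_) (*-identityˡ outdeg) ⟨
      lookup D i + 1 * outdeg                ≡⟨ cong (λ b → lookup D i + 𝟙 b * outdeg) (all i) ⟨
      lookup D i + 𝟙 (F i) * outdeg          ≡⟨ burnt i ⟩
      lookup C i + t + indegree F i          ≡⟨ cong (lookup C i + t +_) (indegree-cong all i) ⟩
      lookup C i + t + (q * 1 + 1)           ≡⟨ rearrange (lookup C i) q t ⟩
      lookup C i + outdeg                    ∎))
      where
        open ≡-Reasoning
        rearrange : ∀ c q t → c + t + (q * 1 + 1) ≡ c + (1 + q + t)
        rearrange = solve-∀

    unburnt-insert : ∀ F w → F w ≡ false → unburnt k (insert F w) < unburnt k F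
    unburnt-insert F w Fw =
      unburnt-mono-< k F (insert F w) (λ j Fj → ∨-trueʳ (w == j) Fj) w Fw (∨-trueˡ (F w) (==-refl w))

    burn : ∀ n D F → unburnt k F ≤ n → Burnt D F → Path D C
    burn n D F bound burnt with any? (λ i → F i Bool.≟ false)
    ... | no none = subst (λ X → Path X C) (sym (burnt-all⇒≡ burnt all)) ε
      where
        all : ∀ i → F i ≡ true
        all i = ¬-not (λ Fi → none (i , Fi))
    ... | yes (i , Fi) with ready-vertex F i Fi | n
    ...   | w , ready | zero  = ⊥-elim (n≮0 (≤-trans (unburnt-insert F w (proj₁ ready)) bound))
    ...   | w , ready | suc n = rim w (ready⇒canFire {D} {F} {w} burnt ready)
                              ◅ burn n _ (insert F w) (s≤s⁻¹ (≤-trans (unburnt-insert F w (proj₁ ready)) bound))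
                                     (burnt-fire {D} burnt ready)

    pattern⇒critical : Critical q t k C
    pattern⇒critical =
      stable , ◅⋆⇒⁺ (bank stable) (burn k _ (λ _ → false) (≤-reflexive (unburnt-∅ k)) burnt-start)

  critical⇔pattern : 1 ≤ t → ∀ C → Critical q t k C ⇔ CriticalPattern C
  critical⇔pattern 1≤t C = mk⇔ (critical⇒pattern 1≤t C) (pattern⇒critical C)

-- Block decompositions as accepted words

-- a finite automaton for the concatenations of blocks: start, inside B M…M, inside 0 q…q
data State : Set where
  start inBlock inTail : State

module Automaton (q t : ℕ) where

  data Step : State → ℕ → State → Set where
    onB : ∀ {s x} → IsB q t x → Step s x inBlock
    onM : ∀ {x} → IsM q t x → Step inBlock x inBlock
    on0 : ∀ {x} → x ≡ 0 → Step inBlock x inTail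
    onQ : ∀ {x} → x ≡ q → Step inTail x inTail

  infixr 5 _∷_
  data Accepts : State → List ℕ → Set where
    endBlock : Accepts inBlock []
    endTail  : Accepts inTail []
    _∷_      : ∀ {s s′ x xs} → Step s x s′ → Accepts s′ xs → Accepts s (x ∷ xs)

  AcceptsFrom⁺ : List ℕ → Set
  AcceptsFrom⁺ xs = Accepts inBlock xs × Accepts inTail xs

  Ms-accepted : ∀ {Ms xs} → All (IsM q t) Ms → Accepts inBlock xs → Accepts inBlock (Ms ++ xs)
  Ms-accepted []       a = a
  Ms-accepted (m ∷ ms) a = onM m ∷ Ms-accepted ms a

  qs-accepted : ∀ n {xs} → Accepts inTail xs → Accepts inTail (replicate n q ++ xs)
  qs-accepted zero    a = a
  qs-accepted (suc n) a = onQ refl ∷ qs-accepted n a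

  block-accepted : ∀ {b xs} → IsBlock q t b → AcceptsFrom⁺ xs → ∀ s → Accepts s (b ++ xs)
  block-accepted (form1 isB ms) (aB , _) s = onB isB ∷ Ms-accepted ms aB
  block-accepted {xs = xs} (form2 {Ms = Ms} isB ms) (_ , aT) s =
    onB isB ∷ subst (Accepts inBlock) (sym (++-assoc Ms [ 0 ] xs)) (Ms-accepted ms (on0 refl ∷ aT))
  block-accepted {xs = xs} (form3 {Ms = Ms} n isB ms) (_ , aT) s =
    onB isB ∷ subst (Accepts inBlock) (sym (++-assoc Ms (0 ∷ replicate n q) xs))
                     (Ms-accepted ms (on0 refl ∷ qs-accepted n aT))

  blocks-accepted⁺ : ∀ {bs} → All (IsBlock q t) bs → AcceptsFrom⁺ (concat bs)
  blocks-accepted⁺ []       = endBlock , endTail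
  blocks-accepted⁺ (b ∷ bs) = block-accepted b rest inBlock , block-accepted b rest inTail
    where rest = blocks-accepted⁺ bs

  blocks⇒accepts : ∀ {bs x xs} → All (IsBlock q t) bs → concat bs ≡ x ∷ xs → Accepts start (x ∷ xs)
  blocks⇒accepts (b ∷ bs) eq = subst (Accepts start) eq (block-accepted b (blocks-accepted⁺ bs) start)

  Blocks : List ℕ → Set
  Blocks xs = ∃ λ bs → All (IsBlock q t) bs × concat bs ≡ xs

  replicate-∷ʳ : ∀ n (xs : List ℕ) → replicate n q ++ q ∷ xs ≡ replicate (suc n) q ++ xs
  replicate-∷ʳ zero    xs = refl
  replicate-∷ʳ (suc n) xs = cong (q ∷_) (replicate-∷ʳ n xs)

  parse-inBlock : ∀ {xs} → Accepts inBlock xs → ∀ B Ms → IsB q t B → All (IsM q t) Ms →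
                  Blocks (B ∷ Ms ++ xs)
  parse-inTail  : ∀ {xs} → Accepts inTail xs → ∀ B Ms n → IsB q t B → All (IsM q t) Ms →
                  Blocks (B ∷ Ms ++ 0 ∷ replicate n q ++ xs)
  parse-inBlock endBlock B Ms isB ms = (B ∷ Ms) ∷ [] , form1 isB ms ∷ [] , refl
  parse-inBlock (onB {x = x} isB′ ∷ a) B Ms isB ms with parse-inBlock a x [] isB′ []
  ... | bs , blocks , eq = (B ∷ Ms) ∷ bs , form1 isB ms ∷ blocks , cong (λ z → B ∷ Ms ++ z) eq
  parse-inBlock (onM {x = x} isM ∷ a) B Ms isB ms with parse-inBlock a B (Ms ++ [ x ]) isB (++⁺ ms (isM ∷ []))
  ... | bs , blocks , eq = bs , blocks , trans eq (cong (B ∷_) (++-assoc Ms [ x ] _))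
  parse-inBlock (on0 refl ∷ a) B Ms isB ms = parse-inTail a B Ms 0 isB ms
  parse-inTail endTail B Ms n isB ms = (B ∷ Ms ++ 0 ∷ replicate n q) ∷ [] , form3 n isB ms ∷ [] ,
    cong (B ∷_) (++-assoc Ms (0 ∷ replicate n q) [])
  parse-inTail (onB {x = x} isB′ ∷ a) B Ms n isB ms with parse-inBlock a x [] isB′ []
  ... | bs , blocks , eq = (B ∷ Ms ++ 0 ∷ replicate n q) ∷ bs , form3 n isB ms ∷ blocks ,
    cong (B ∷_) (trans (++-assoc Ms (0 ∷ replicate n q) _) (cong (λ z → Ms ++ 0 ∷ replicate n q ++ z) eq))
  parse-inTail (_∷_ {xs = xs} (onQ refl) a) B Ms n isB ms with parse-inTail a B Ms (suc n) isB ms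
  ... | bs , blocks , eq = bs , blocks , trans eq (cong (λ z → B ∷ Ms ++ 0 ∷ z) (sym (replicate-∷ʳ n xs)))

  accepts⇒blocks : ∀ {xs} → Accepts start xs → Blocks xs
  accepts⇒blocks (onB isB ∷ a) = parse-inBlock a _ [] isB []

window : (ℕ → ℕ) → ℕ → ℕ → List ℕ
window c s zero    = []
window c s (suc n) = c s ∷ window c (suc s) n

module _ (c : ℕ → ℕ) where

  length-window : ∀ s n → length (window c s n) ≡ n
  length-window s zero    = refl
  length-window s (suc n) = cong suc (length-window (suc s) n)

  window-++ : ∀ s a b → window c s a ++ window c (s + a) b ≡ window c s (a + b)
  window-++ s zero    b = cong (λ z → window c z b) (+-identityʳ s)
  window-++ s (suc a) b = cong (c s ∷_) (trans (cong (λ z → window c (suc s) a ++ window c z b) (+-suc s a))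
                                               (window-++ (suc s) a b))

  drop-window : ∀ s n r → r ≤ n → drop r (window c s n) ≡ window c (s + r) (n ∸ r)
  drop-window s n       zero    _  = cong (λ z → window c z n) (sym (+-identityʳ s))
  drop-window s (suc n) (suc r) le =
    trans (drop-window (suc s) n r (s≤s⁻¹ le)) (cong (λ z → window c z (n ∸ r)) (sym (+-suc s r)))

  take-window : ∀ s n r → r ≤ n → take r (window c s n) ≡ window c s r
  take-window s n       zero    _  = refl
  take-window s (suc n) (suc r) le = cong (c s ∷_) (take-window (suc s) n r (s≤s⁻¹ le))

  window-periodic : ∀ k → (∀ p → c (p + k) ≡ c p) → ∀ s n → window c (s + k) n ≡ window c s n
  window-periodic k periodic s zero    = refl
  window-periodic k periodic s (suc n) = cong₂ _∷_ (periodic s) (window-periodic k periodic (suc s) n)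

  rotate-window≤ : ∀ k → (∀ p → c (p + k) ≡ c p) →
                   ∀ {r} → r ≤ k → rotate r (window c 0 k) ≡ window c r k
  rotate-window≤ k periodic {r} r≤k = begin
    drop r (window c 0 k) ++ take r (window c 0 k)
      ≡⟨ cong₂ _++_ (drop-window 0 k r r≤k) (take-window 0 k r r≤k) ⟩
    window c r (k ∸ r) ++ window c 0 r
      ≡⟨ cong (window c r (k ∸ r) ++_) (window-periodic k periodic 0 r) ⟨
    window c r (k ∸ r) ++ window c k r
      ≡⟨ cong (λ z → window c r (k ∸ r) ++ window c z r) (m+[n∸m]≡n r≤k) ⟨
    window c r (k ∸ r) ++ window c (r + (k ∸ r)) r
      ≡⟨ window-++ r (k ∸ r) r ⟩
    window c r (k ∸ r + r)
      ≡⟨ cong (window c r) (m∸n+n≡m r≤k) ⟩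
    window c r k ∎
    where open ≡-Reasoning

  rotate-window : ∀ k → (∀ p → c (p + k) ≡ c p) →
                  ∀ r → ∃ λ s → rotate r (window c 0 k) ≡ window c s k
  rotate-window k periodic r with r ≤? k
  ... | yes r≤k = r , rotate-window≤ k periodic r≤k
  ... | no r≰k = 0 , cong₂ _++_ (drop-all r _ long) (take-all r _ long)
    where long = ≤-trans (≤-reflexive (length-window 0 k)) (<⇒≤ (≰⇒> r≰k))

window-suc : ∀ c s n → window c (suc s) n ≡ window (λ p → c (suc p)) s n
window-suc c s zero    = refl
window-suc c s (suc n) = cong (c (suc s) ∷_) (window-suc c (suc s) n)

toList-window : ∀ {n} (xs : Vec ℕ n) c → (∀ p (p<n : p < n) → c p ≡ lookup xs (fromℕ< p<n)) →
                toList xs ≡ window c 0 n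
toList-window []       c agree = refl
toList-window (x ∷ xs) c agree = cong₂ _∷_ (sym (agree 0 (s≤s z≤n)))
  (trans (toList-window xs (λ p → c (suc p)) (λ p p<n → agree (suc p) (s≤s p<n))) (sym (window-suc c 0 _)))

module Sequence (q t : ℕ) (c : ℕ → ℕ) where
  open Automaton q t

  module _ (bounded : ∀ p → c p ≤ q + t) (zeros : ZerosResolved q c) where

    accepts-inBlock : ∀ n s → Accepts inBlock (window c s n)
    accepts-inTail  : ∀ n s m → QRun q c s m → q < c (s + m) → Accepts inTail (window c s n)
    accepts-inBlock zero    s = endBlock
    accepts-inBlock (suc n) s with q <? c s | c s ≟ 0
    ... | yes q<c | _ = onB (q<c , bounded s) ∷ accepts-inBlock n (suc s)
    ... | no q≮c | no c≢0 = onM (n≢0⇒n>0 c≢0 , ≮⇒≥ q≮c) ∷ accepts-inBlock n (suc s)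
    ... | no _   | yes c≡0 with zeros s c≡0
    ...   | m , run , q<end = on0 c≡0 ∷ accepts-inTail n (suc s) m run q<end
    accepts-inTail zero    s m       run q<end = endTail
    accepts-inTail (suc n) s zero    run q<end =
      onB (subst (λ z → q < c z) (+-identityʳ s) q<end , bounded s) ∷ accepts-inBlock n (suc s)
    accepts-inTail (suc n) s (suc m) run q<end =
      onQ (trans (cong c (sym (+-identityʳ s))) (run 0 (s≤s z≤n)))
      ∷ accepts-inTail n (suc s) m (λ e e<m → trans (cong c (sym (+-suc s e))) (run (suc e) (s≤s e<m)))
                                   (subst (λ z → q < c z) (+-suc s m) q<end)

    accepts-start : ∀ n s → q < c s → Accepts start (window c s (suc n))
    accepts-start n s q<c = onB (q<c , bounded s) ∷ accepts-inBlock n (suc s)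

  accepts-suffix : ∀ {st} s n → Accepts st (window c s n) → ∀ d → d < n →
                   ∃ λ st′ → Accepts st′ (window c (s + d) (suc (n ∸ suc d)))
  accepts-suffix {st} s (suc n) acc zero _ =
    st , subst (λ z → Accepts st (window c z (suc n))) (sym (+-identityʳ s)) acc
  accepts-suffix s (suc n) (_ ∷ acc) (suc d) d<n with accepts-suffix (suc s) n acc d (s≤s⁻¹ d<n)
  ... | st′ , acc′ = st′ , subst (λ z → Accepts st′ (window c z (suc (n ∸ suc d)))) (sym (+-suc s d)) acc′

  head-bounded : ∀ {st x xs} → Accepts st (x ∷ xs) → x ≤ q + t
  head-bounded (onB (_ , B≤) ∷ _) = B≤
  head-bounded (onM (_ , M≤) ∷ _) = ≤-trans M≤ (m≤m+n q t)
  head-bounded (on0 refl ∷ _)     = z≤n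
  head-bounded (onQ refl ∷ _)     = m≤m+n q t

  tail-run : ∀ s n → Accepts inTail (window c s n) → ∃ λ m → QRun q c s m × (m ≡ n ⊎ q < c (s + m))
  tail-run s zero    _                   = 0 , (λ e ()) , inj₁ refl
  tail-run s (suc n) (onB (q<B , _) ∷ _) =
    0 , (λ e ()) , inj₂ (subst (λ z → q < c z) (sym (+-identityʳ s)) q<B)
  tail-run s (suc n) (onQ c≡q ∷ acc) with tail-run (suc s) n acc
  ... | m , run , end = suc m , run′ , Sum.map (cong suc) (subst (λ z → q < c z) (sym (+-suc s m))) end
    where
      run′ : QRun q c s (suc m)
      run′ zero    _       = trans (cong c (+-identityʳ s)) c≡q
      run′ (suc e) e<1+m = trans (cong c (+-suc s e)) (run e (s≤s⁻¹ e<1+m))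

  after-zero : ∀ {st} s n → Accepts st (window c s (suc n)) → c s ≡ 0 →
               ∃ λ m → QRun q c (suc s) m × (m ≡ n ⊎ q < c (suc s + m))
  after-zero s n (onB (q<B , _) ∷ _)   c≡0 = ⊥-elim (<⇒≱ q<B (≤-trans (≤-reflexive c≡0) z≤n))
  after-zero s n (onM (1≤M , _) ∷ _)   c≡0 = ⊥-elim (<⇒≱ 1≤M (≤-reflexive c≡0))
  after-zero s n (on0 _ ∷ acc)          c≡0 = tail-run (suc s) n acc
  after-zero s n (onQ _ ∷ acc)          c≡0 = tail-run (suc s) n acc

  start-head-big : ∀ s n → Accepts start (window c s n) → q < c s
  start-head-big s (suc n) (onB (q<B , _) ∷ _) = q<B

  module AcceptedWindow (k r : ℕ) (periodic : c (r + k) ≡ c r)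
           (shift : ∀ p → ∃ λ d → d < k × ∀ e → c (p + e) ≡ c (r + d + e))
           (acc : Accepts start (window c r k)) where

    window-position : ∀ {p d} → (∀ e → c (p + e) ≡ c (r + d + e)) → c (r + d) ≡ c p
    window-position {p} {d} sh =
      trans (cong c (sym (+-identityʳ (r + d)))) (trans (sym (sh 0)) (cong c (+-identityʳ p)))

    window-bounded : ∀ p → c p ≤ q + t
    window-bounded p with shift p
    ... | d , d<k , sh with accepts-suffix r k acc d d<k
    ...   | _ , acc′ = subst (_≤ q + t) (window-position sh) (head-bounded acc′)

    window-zerosResolved : ZerosResolved q c
    window-zerosResolved p c≡0 with shift p
    ... | d , d<k , sh with accepts-suffix r k acc d d<k
    ...   | _ , acc′ with after-zero (r + d) (k ∸ suc d) acc′ (trans (window-position sh) c≡0)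
    ...     | m , run , end = m , (λ e e<m → trans (moved e) (run e e<m)) , reached end
      where
        moved : ∀ e → c (suc p + e) ≡ c (suc (r + d) + e)
        moved e = trans (cong c (sym (+-suc p e))) (trans (sh (suc e)) (cong c (+-suc (r + d) e)))
        wraps : suc (r + d) + (k ∸ suc d) ≡ r + k
        wraps = trans (cong (_+ (k ∸ suc d)) (sym (+-suc r d)))
                      (trans (+-assoc r (suc d) (k ∸ suc d)) (cong (r +_) (m+[n∸m]≡n d<k)))
        reached : (m ≡ k ∸ suc d ⊎ q < c (suc (r + d) + m)) → q < c (suc p + m)
        reached (inj₂ q<end) = subst (q <_) (sym (moved m)) q<end
        -- a run of q's reaching the end of the window is closed by its first value, a B
        reached (inj₁ refl)  =
          subst (q <_) (sym (trans (moved m) (trans (cong c wraps) periodic))) (start-head-big r k acc)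

module Correspondence (q t k : ℕ) .{{_ : NonZero k}} where
  open Cyclic k
  open Pattern q t k
  open Automaton q t

  module _ (C : Config k) where
    open Sequence q t (C ⟨_⟩)

    toList≡window : toList C ≡ window (C ⟨_⟩) 0 k
    toList≡window = toList-window C (C ⟨_⟩) λ p p<k →
      cong (lookup C) (trans (cong (_mod k) (sym (toℕ-fromℕ< p<k))) (mod-toℕ (fromℕ< p<k)))

    periodic : ∀ p → C ⟨ p + k ⟩ ≡ C ⟨ p ⟩
    periodic p = cong (lookup C) (mod-+-periodic p)

    shift : ∀ r p → ∃ λ d → d < k × ∀ e → C ⟨ p + e ⟩ ≡ C ⟨ r + d + e ⟩
    shift r p with mod-reach r (p mod k)
    ... | d , d<k , eq = d , d<k , λ e → cong (lookup C) (mod-+-cong e (sym eq))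

    window-unfold : ∀ s → window (C ⟨_⟩) s k ≡ C ⟨ s ⟩ ∷ window (C ⟨_⟩) (suc s) (pred k)
    window-unfold s = cong (window (C ⟨_⟩) s) (sym (suc-pred k))

    rotate-toList≤ : ∀ {r} → r ≤ k → rotate r (toList C) ≡ window (C ⟨_⟩) r k
    rotate-toList≤ {r} r≤k = trans (cong (rotate r) toList≡window) (rotate-window≤ (C ⟨_⟩) k periodic r≤k)

    pattern-window-accepted : CriticalPattern C → ∀ s → q < C ⟨ s ⟩ → Accepts start (window (C ⟨_⟩) s k)
    pattern-window-accepted pat s q<c = subst (Accepts start) (sym (window-unfold s))
      (accepts-start (λ p → s≤s⁻¹ (stable (p mod k))) zeros (pred k) s q<c)
      where open CriticalPattern pat

    pattern⇒circularBlocks : CriticalPattern C → CircularBlocks q t k C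
    pattern⇒circularBlocks pat with CriticalPattern.big pat
    ... | b , q<b with accepts⇒blocks (pattern-window-accepted pat (toℕ b) q<c)
      where q<c = subst (q <_) (sym (cong (lookup C) (mod-toℕ b))) q<b
    ...   | bs , blocks , eq = toℕ b , bs , blocks , trans eq (sym (rotate-toList≤ (<⇒≤ (toℕ<n b))))

    circularBlocks⇒pattern : CircularBlocks q t k C → CriticalPattern C
    circularBlocks⇒pattern (r , bs , blocks , eq) with rotate-window (C ⟨_⟩) k periodic r
    ... | s , rotated = record
      { stable = λ i → s≤s (subst (_≤ q + t) (cong (lookup C) (mod-toℕ i)) (window-bounded (toℕ i)))
      ; big    = s mod k , start-head-big s k accepted
      ; zeros  = window-zerosResolved
      }
      where
        accepted : Accepts start (window (C ⟨_⟩) s k)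
        accepted = subst (Accepts start) (sym (window-unfold s))
          (blocks⇒accepts blocks (trans eq (trans (cong (rotate r) toList≡window)
                                                  (trans rotated (window-unfold s)))))
        open AcceptedWindow k s (periodic s) (shift s) accepted

    pattern⇔circularBlocks : CriticalPattern C ⇔ CircularBlocks q t k C
    pattern⇔circularBlocks = mk⇔ pattern⇒circularBlocks circularBlocks⇒pattern

theorem5 : (q t k : ℕ) → 1 ≤ t → .{{_ : NonZero k}} → (C : Config k) →
           Critical q t k C ⇔ CircularBlocks q t k C
theorem5 q t k 1≤t C = pattern⇔circularBlocks C ⇔-∘ critical⇔pattern 1≤t C
  where
    open Burning q t k
    open Correspondence q t k
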